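{- Let $M$ be a matroid with ground set $E$ and rank function $r$, and let $k>0$ be an integer. Then $\vec S_k$ is $\mathcal F_k$-separable.
   Context: $\lambda(X)=r(X)+r(E\setminus X)-r(M)$. $\vec U$ is the set of ordered bipartitions $(X,Y)$ of $E$ (parts may be empty), ordered by $(A,B)\le(C,D)$ iff $A\subseteq C$ and $B\supseteq D$, inverse $(A,B)^*=(B,A)$, join $(A,B)\vee(C,D)=(A\cup C,B\cap D)$, meet $(A\cap C,B\cup D)$; $\mathrm{ord}(X,Y)=\lambda(X)$. $\vec S_k=\{\vec s\in\vec U:\mathrm{ord}(\vec s)<k\}$, $S_k$ the set of unoriented separations $s=\{\vec s,\vec s^{\,*}\}$. A star is a set $\sigma$ with $\vec s\ne\vec s^{\,*}$ for each element and $\vec r\le\vec s^{\,*}$ for all distinct $\vec r,\vec s\in\sigma$. For a star $\sigma=\{(A_i,B_i):i=0,\dots,n\}$, $\langle\sigma\rangle=r(M)+\sum_{i=0}^n(r(B_i)-r(M))$; $\mathcal F_k$ is the set of stars $\sigma\subseteq\vec U$ with $\langle\sigma\rangle<k$. Let $\vec S=\vec S_k$. $\vec s$ is degenerate if $\vec s=\vec s^{\,*}$; $\vec r\in\vec S$ is trivial in $\vec S$ if some $s\in S$ has $\vec r<\vec s$ and $\vec r<\vec s^{\,*}$. $\mathcal F$ forces $\vec s$ if $\{\vec s^{\,*}\}\in\mathcal F$. $\vec s_0\in\vec S$ emulates $\vec r$ in $\vec S$ if $\vec s_0\ge\vec r$ and $\vec s\vee\vec s_0\in\vec S$ for all $\vec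 s\in\vec S\setminus\{\vec r^{\,*}\}$ with $\vec s\ge\vec r$. For nontrivial nondegenerate $\vec r\le\vec s_0$, let $\vec S_{\ge\vec r}$ be the set of orientations of those $s\in S$ having an orientation $\ge\vec r$, and define $f$ on $\vec S_{\ge\vec r}\setminus\{\vec r^{\,*}\}$ by $f(\vec s)=\vec s\vee\vec s_0$, $f(\vec s^{\,*})=(\vec s\vee\vec s_0)^*$ for $\vec s\ge\vec r$. $\vec s_0$ emulates $\vec r$ in $\vec S$ for $\mathcal F$ if it emulates $\vec r$ in $\vec S$ and $f(\sigma)\in\mathcal F$ for every star $\sigma\subseteq\vec S_{\ge\vec r}\setminus\{\vec r^{\,*}\}$ in $\mathcal F$ with an element $\ge\vec r$. $\vec S$ is $\mathcal F$-separable if for all nontrivial nondegenerate $\vec r,\vec r\,'\in\vec S$ not forced by $\mathcal F$ with $\vec r\le(\vec r\,')^*$, there is $\vec s_0\in\vec S$ that emulates $\vec r$ in $\vec S$ for $\mathcal F$ and such that $\vec s_0^{\,*}$ emulates $\vec r\,'$ in $\vec S$ for $\mathcal F$. -}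

module Defs where

open import Data.Nat using (ℕ; _+_; _∸_; _≤_; _<_)
open import Data.Integer as ℤ using (ℤ; +_)
open import Data.Bool using (Bool)
import Data.Bool.Properties as BoolP
open import Data.Fin.Subset using (Subset; _⊆_; _∪_; _∩_; ∁; ⊤; ∣_∣)
open import Data.Fin.Subset.Properties using (_⊆?_)
open import Data.Vec.Properties using (≡-dec)
open import Data.List using (List; []; _∷_; map; deduplicate; foldr)
open import Data.List.Membership.Propositional using (_∈_)
open import Data.Product using (_×_; Σ; ∃; _,_)
open import Data.Sum using (_⊎_)
open import Relation.Nullary using (¬_; yes; no)
open import Relation.Binary.PropositionalEquality using (_≡_; _≢_)
open import Relation.Binary.Definitions using (DecidableEquality)

record Matroid : Set where
  field
    n       : ℕ
    r       : Subset n → ℕ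
    r-bound : ∀ X → r X ≤ ∣ X ∣
    r-mono  : ∀ X Y → X ⊆ Y → r X ≤ r Y
    r-sub   : ∀ X Y → r (X ∪ Y) + r (X ∩ Y) ≤ r X + r Y

module Theory (M : Matroid) (k : ℕ) where
  open Matroid M

  E : Subset n
  E = ⊤

  rM : ℕ
  rM = r E

  -- connectivity function λ(X) = r(X) + r(E∖X) − r(M)
  -- (truncated subtraction; by submodularity the value is never truncated)
  conn : Subset n → ℕ
  conn X = (r X + r (∁ X)) ∸ rM

  -- An ordered bipartition (X , E∖X) of E is determined by its first part X.
  Sep : Set
  Sep = Subset n

  small : Sep → Subset n
  small s = s

  big : Sep → Subset n
  big s = ∁ s

  _* : Sep → Sep
  s * = ∁ s

  _≼_ : Sep → Sep → Set
  s ≼ t = (small s ⊆ small t) × (big t ⊆ big s)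

  _≺_ : Sep → Sep → Set
  s ≺ t = (s ≼ t) × (s ≢ t)

  _∨ₛ_ : Sep → Sep → Sep
  s ∨ₛ t = small s ∪ small t

  ord : Sep → ℕ
  ord s = conn (small s)

  InS : Sep → Set
  InS s = ord s < k

  _≟ₛ_ : DecidableEquality Sep
  _≟ₛ_ = ≡-dec BoolP._≟_

  -- sets of separations are represented by lists (up to membership);
  -- set-level quantities are computed on the deduplicated list
  SepSet : Set
  SepSet = List Sep

  IsStar : SepSet → Set
  IsStar σ = (∀ s → s ∈ σ → s ≢ s *) ×
             (∀ s t → s ∈ σ → t ∈ σ → s ≢ t → s ≼ (t *))

  sumℤ : List ℤ → ℤ
  sumℤ = foldr ℤ._+_ (+ 0)

  starOrd : SepSet → ℤ
  starOrd σ = + rM ℤ.+ sumℤ (map (λ s → + r (big s) ℤ.- + rM) (deduplicate _≟ₛ_ σ))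

  InF : SepSet → Set
  InF σ = IsStar σ × (starOrd σ ℤ.< + k)

  degenerate : Sep → Set
  degenerate s = s ≡ s *

  trivial : Sep → Set
  trivial x = ∃ λ t → InS t × (x ≺ t) × (x ≺ (t *))

  forced : Sep → Set
  forced s = InF (s * ∷ [])

  emulates : Sep → Sep → Set
  emulates s₀ x = InS s₀ × (x ≼ s₀) ×
    (∀ s → InS s → s ≢ x * → x ≼ s → InS (s ∨ₛ s₀))

  InS≥ : Sep → Sep → Set
  InS≥ x t = InS t × ((x ≼ t) ⊎ (x ≼ (t *)))

  -- the map f (well defined on S⃗_{≥r} ∖ {r*} for nontrivial nondegenerate r ≤ s₀)
  fmap : Sep → Sep → Sep → Sep
  fmap s₀ x t with x ⊆? t | ∁ t ⊆? ∁ x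
  ... | yes _ | yes _ = t ∨ₛ s₀
  ... | _     | _     = ((t *) ∨ₛ s₀) *

  emulatesFor : Sep → Sep → Set
  emulatesFor s₀ x = emulates s₀ x ×
    (∀ σ → (∀ t → t ∈ σ → InS≥ x t × t ≢ x *) → InF σ →
       (∃ λ t → t ∈ σ × x ≼ t) → InF (map (fmap s₀ x) σ))

  nice : Sep → Set
  nice x = InS x × ¬ trivial x × ¬ degenerate x × ¬ forced x

  Separable : Set
  Separable = ∀ x x′ → nice x → nice x′ → x ≼ (x′ *) →
    ∃ λ s₀ → InS s₀ × emulatesFor s₀ x × emulatesFor (s₀ *) x′

Separable : Matroid → ℕ → Set
Separable M k = Theory.Separable M k

-- Choose X between x and x′* of minimal connectivity. Uncrossing with X, that is,
-- submodularity of λ together with the minimality of X, shows that X emulates x and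
-- X* emulates x′. Let σ ∈ F_k have an element t₀ ≥ x. The other elements of σ are
-- disjoint from t₀, hence (as x ≠ ∅) not ≥ x, so f maps t₀ to t₀ ∨ X and every other t to
-- t ∧ X*. The images are pairwise disjoint and thus form a star; two elements can
-- only share an image if it is (∅, E), which contributes nothing to ⟨·⟩. Applying
-- rank submodularity to the elements of σ one at a time, and closing the chain with
-- the minimality of X, shows that Σ r(B_i) does not increase, so ⟨f(σ)⟩ ≤ ⟨σ⟩.
module Submission where

open import Defs
open import Function using (_∘_; case_of_)
open import Data.Nat using (ℕ; _+_; _*_; _∸_; _≤_; _<_; z≤n)
open import Data.Nat.Properties
  using (≤-reflexive; +-identityʳ; ≤-trans; ≤-<-trans; +-mono-≤; +-monoʳ-≤; +-comm;
         +-cancelʳ-≤; ∸-monoˡ-≤; m∸n+n≡m; m≤n⇒m∸n≡0; n≤0⇒n≡0; ≮⇒≥;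
         +-commutativeSemigroup; module ≤-Reasoning)
  renaming (_≟_ to _≟ℕ_; _<?_ to _<ℕ?_)
open import Data.Nat.Induction using (<-wellFounded)
open import Data.Nat.ListAction using (sum)
open import Data.Nat.ListAction.Properties using (sum-↭)
open import Data.Nat.Tactic.RingSolver using (solve-∀)
open import Algebra.Properties.CommutativeSemigroup +-commutativeSemigroup using (interchange)
open import Data.Integer as ℤ using (ℤ; +_)
import Data.Integer.Properties as ℤP
open import Data.Fin using (Fin)
open import Data.Fin.Subset using (Subset; _⊆_; _∪_; _∩_; ∁; ⊤; ⊥; Nonempty)
  renaming (_∈_ to _∈ₛ_; _∉_ to _∉ₛ_)
open import Data.Fin.Subset.Properties
  using (_⊆?_; _∈?_; nonempty?; anySubset?; Empty-unique; ∣⊥∣≡0; ⊆⊤; ⊆-refl; ⊆-trans;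
         x∈p⇒x∉∁p; x∈∁p⇒x∉p; x∉p⇒x∈∁p; p⊆q⇒∁p⊇∁q;
         x∈p∪q⁻; x∈p∩q⁺; x∈p∩q⁻; p∩q⊆p; p∩q⊆q; p⊆p∪q; q⊆p∪q;
         ∪-∩-booleanAlgebra)
import Algebra.Lattice.Properties.BooleanAlgebra as BooleanAlgebraProperties
open import Data.List using (List; []; _∷_; map; length; deduplicate)
open import Data.List.Properties using (map-∘)
open import Data.List.Membership.Propositional using (_∈_)
open import Data.List.Membership.Propositional.Properties
  using (∈-∃++; ∈-map⁻; ∈-map⁺; ∈-deduplicate⁻; ∈-deduplicate⁺)
open import Data.List.Relation.Unary.Any using (here; there)
open import Data.List.Relation.Unary.All as All using (All; []; _∷_)
open import Data.List.Relation.Unary.AllPairs as AllPairs using (AllPairs; []; _∷_)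
import Data.List.Relation.Unary.AllPairs.Properties as AllPairsP
open import Data.List.Relation.Unary.Unique.Propositional using (Unique)
open import Data.List.Relation.Unary.Unique.DecPropositional.Properties using (deduplicate-!)
open import Data.List.Relation.Binary.Permutation.Propositional using (_↭_)
open import Data.List.Relation.Binary.Permutation.Propositional.Properties
  using (shift; ∈-resp-↭)
  renaming (map⁺ to ↭-map⁺)
open import Data.Product using (_×_; ∃; _,_; proj₁; proj₂)
open import Data.Sum using (inj₁; inj₂)
open import Data.Empty using (⊥-elim)
open import Induction.WellFounded using (Acc; acc)
open import Relation.Nullary using (¬_; yes; no; contradiction)
open import Relation.Nullary.Decidable using (_×-dec_)
open import Relation.Unary using (Pred; Decidable)
open import Relation.Binary using (Rel)
open import Relation.Binary.PropositionalEquality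
  using (_≡_; _≢_; refl; sym; trans; cong; cong₂; subst; subst₂; module ≡-Reasoning)

+-telescope : ∀ a b s s′ q q′ x → a + q ≤ b + q′ → s + q′ ≤ s′ + x → (a + s) + q ≤ (b + s′) + x
+-telescope a b s s′ q q′ x a+q≤b+q′ s+q′≤s′+x = +-cancelʳ-≤ q′ _ _ (begin
  (a + s) + q + q′       ≡⟨ lhs a s q q′ ⟩
  (a + q) + (s + q′)     ≤⟨ +-mono-≤ a+q≤b+q′ s+q′≤s′+x ⟩
  (b + q′) + (s′ + x)    ≡⟨ rhs b s′ x q′ ⟩
  (b + s′) + x + q′      ∎)
  where
  open ≤-Reasoning
  lhs : ∀ a s q q′ → (a + s) + q + q′ ≡ (a + q) + (s + q′)
  lhs = solve-∀
  rhs : ∀ b s′ x q′ → (b + q′) + (s′ + x) ≡ (b + s′) + x + q′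
  rhs = solve-∀

∑ : ∀ {a} {A : Set a} → (A → ℕ) → List A → ℕ
∑ u xs = sum (map u xs)

module _ {a} {A : Set a} where

  ∑-mono : ∀ {u v : A → ℕ} {xs} → All (λ x → u x ≤ v x) xs → ∑ u xs ≤ ∑ v xs
  ∑-mono []         = z≤n
  ∑-mono (le ∷ les) = +-mono-≤ le (∑-mono les)

  ∑-map : ∀ {B : Set a} (u : B → ℕ) (f : A → B) xs → ∑ u (map f xs) ≡ ∑ (u ∘ f) xs
  ∑-map u f xs = cong sum (sym (map-∘ xs))

  ∑-∸-+ : ∀ {u : A → ℕ} {c xs} → All (λ x → u x ≤ c) xs →
          ∑ (λ x → c ∸ u x) xs + ∑ u xs ≡ length xs * c
  ∑-∸-+                       []         = refl
  ∑-∸-+ {u} {c} {x ∷ xs} (ux≤c ∷ les) = begin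
    (c ∸ u x + ∑ (λ y → c ∸ u y) xs) + (u x + ∑ u xs) ≡⟨ interchange (c ∸ u x) _ (u x) _ ⟩
    (c ∸ u x + u x) + (∑ (λ y → c ∸ u y) xs + ∑ u xs) ≡⟨ cong₂ _+_ (m∸n+n≡m ux≤c) (∑-∸-+ les) ⟩
    c + length xs * c                                   ∎
    where open ≡-Reasoning

  ∑-∸-antitone : ∀ {u v : A → ℕ} {c xs} → All (λ x → u x ≤ c) xs → All (λ x → v x ≤ c) xs →
                 ∑ u xs ≤ ∑ v xs → ∑ (λ x → c ∸ v x) xs ≤ ∑ (λ x → c ∸ u x) xs
  ∑-∸-antitone {u} {v} {c} {xs} u≤c v≤c ∑u≤∑v = +-cancelʳ-≤ (∑ u xs) _ _ (begin
    ∑ (λ x → c ∸ v x) xs + ∑ u xs ≤⟨ +-monoʳ-≤ _ ∑u≤∑v ⟩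
    ∑ (λ x → c ∸ v x) xs + ∑ v xs ≡⟨ ∑-∸-+ v≤c ⟩
    length xs * c                 ≡⟨ ∑-∸-+ u≤c ⟨
    ∑ (λ x → c ∸ u x) xs + ∑ u xs ∎)
    where open ≤-Reasoning

  ∈⇒↭∷ : ∀ {x : A} {ys} → x ∈ ys → ∃ λ zs → ys ↭ x ∷ zs
  ∈⇒↭∷ x∈ys with ps , qs , refl ← ∈-∃++ x∈ys = _ , shift _ ps qs

  ∑-⊆ : ∀ {u : A → ℕ} {xs ys} → AllPairs (λ x y → x ≡ y → u x ≡ 0) xs →
        (∀ {x} → x ∈ xs → x ∈ ys) → ∑ u xs ≤ ∑ u ys
  ∑-⊆ [] _ = z≤n
  ∑-⊆ {u} {x ∷ xs} {ys} (x-reps ∷ reps) xs⊆ys with u x ≟ℕ 0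
  ... | yes ux≡0 rewrite ux≡0 = ∑-⊆ reps (xs⊆ys ∘ there)
  ... | no ux≢0 with zs , ys↭x∷zs ← ∈⇒↭∷ (xs⊆ys (here refl)) = begin
    u x + ∑ u xs ≤⟨ +-monoʳ-≤ (u x) (∑-⊆ reps xs⊆zs) ⟩
    u x + ∑ u zs ≡⟨ sum-↭ (↭-map⁺ u ys↭x∷zs) ⟨
    ∑ u ys       ∎
    where
    open ≤-Reasoning
    xs⊆zs : ∀ {y} → y ∈ xs → y ∈ zs
    xs⊆zs y∈xs with ∈-resp-↭ ys↭x∷zs (xs⊆ys (there y∈xs))
    ... | here y≡x  = contradiction (All.lookup x-reps y∈xs (sym y≡x)) ux≢0
    ... | there y∈zs = y∈zs

Unique⇒AllPairs : ∀ {a ℓ} {A : Set a} {R : Rel A ℓ} {xs} → Unique xs →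
                  (∀ {x y} → x ∈ xs → y ∈ xs → x ≢ y → R x y) → AllPairs R xs
Unique⇒AllPairs []              _ = []
Unique⇒AllPairs (x≢xs ∷ unique) R-∈ =
  All.tabulate (λ y∈xs → R-∈ (here refl) (there y∈xs) (All.lookup x≢xs y∈xs))
  ∷ Unique⇒AllPairs unique (λ x∈ y∈ → R-∈ (there x∈) (there y∈))

module _ {n : ℕ} where

  open BooleanAlgebraProperties (∪-∩-booleanAlgebra n) public
    using () renaming (¬-involutive to ∁-involutive; deMorgan₁ to ∁-∩; deMorgan₂ to ∁-∪)

  ∁-∁∪ : ∀ (p q : Subset n) → ∁ (∁ p ∪ q) ≡ p ∩ ∁ q
  ∁-∁∪ p q = trans (∁-∪ (∁ p) q) (cong (_∩ ∁ q) (∁-involutive p))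

  ∁-injective : ∀ {p q : Subset n} → ∁ p ≡ ∁ q → p ≡ q
  ∁-injective {p} {q} ∁p≡∁q = trans (sym (∁-involutive p)) (trans (cong ∁ ∁p≡∁q) (∁-involutive q))

  ∁-∩∁ : ∀ (p q : Subset n) → ∁ (p ∩ ∁ q) ≡ ∁ p ∪ q
  ∁-∩∁ p q = trans (∁-∩ p (∁ q)) (cong (∁ p ∪_) (∁-involutive q))

  Disjoint : Rel (Subset n) _
  Disjoint p q = p ⊆ ∁ q

  disjoint : ∀ {p q : Subset n} → (∀ {i} → i ∈ₛ p → i ∉ₛ q) → Disjoint p q
  disjoint no-common i∈p = x∉p⇒x∈∁p (no-common i∈p)

  disjoint-sym : ∀ {p q : Subset n} → Disjoint p q → Disjoint q p
  disjoint-sym p⊆∁q = disjoint λ i∈q i∈p → x∈∁p⇒x∉p (p⊆∁q i∈p) i∈q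

  disjoint-mono : ∀ {p p′ q q′ : Subset n} → p′ ⊆ p → q′ ⊆ q → Disjoint p q → Disjoint p′ q′
  disjoint-mono p′⊆p q′⊆q p⊆∁q i∈p′ = p⊆q⇒∁p⊇∁q q′⊆q (p⊆∁q (p′⊆p i∈p′))

  disjoint-∪-∩∁ : ∀ {p q : Subset n} X → Disjoint p q → Disjoint (p ∪ X) (q ∩ ∁ X)
  disjoint-∪-∩∁ {p} {q} X p⊆∁q = disjoint λ i∈p∪X i∈q∩∁X →
    let i∈q , i∈∁X = x∈p∩q⁻ q (∁ X) i∈q∩∁X in
    case x∈p∪q⁻ p X i∈p∪X of λ where
      (inj₁ i∈p) → x∈∁p⇒x∉p (p⊆∁q i∈p) i∈q
      (inj₂ i∈X) → x∈∁p⇒x∉p i∈∁X i∈X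

  ∪-least : ∀ {p q r : Subset n} → p ⊆ r → q ⊆ r → p ∪ q ⊆ r
  ∪-least {p} {q} p⊆r q⊆r i∈p∪q with x∈p∪q⁻ p q i∈p∪q
  ... | inj₁ i∈p = p⊆r i∈p
  ... | inj₂ i∈q = q⊆r i∈q

  ∩-greatest : ∀ {p q r : Subset n} → p ⊆ q → p ⊆ r → p ⊆ q ∩ r
  ∩-greatest p⊆q p⊆r i∈p = x∈p∩q⁺ (p⊆q i∈p , p⊆r i∈p)

  self-disjoint⇒⊤⊆∁ : ∀ {p : Subset n} → Disjoint p p → ⊤ ⊆ ∁ p
  self-disjoint⇒⊤⊆∁ {p} p⊆∁p {i} _ with i ∈? p
  ... | yes i∈p = p⊆∁p i∈p
  ... | no  i∉p = x∉p⇒x∈∁p i∉p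

  ∁-fixpoint-free : Fin n → ∀ (p : Subset n) → p ≢ ∁ p
  ∁-fixpoint-free i p p≡∁p with i ∈? p
  ... | yes i∈p = x∈p⇒x∉∁p i∈p (subst (i ∈ₛ_) p≡∁p i∈p)
  ... | no  i∉p = i∉p (subst (i ∈ₛ_) (sym p≡∁p) (x∉p⇒x∈∁p i∉p))

module _ {n ℓ} {P : Pred (Subset n) ℓ} (P? : Decidable P) (f : Subset n → ℕ) where

  minimiser-exists : ∀ {z} → P z → ∃ λ w → P w × ∀ {v} → P v → f w ≤ f v
  minimiser-exists {z} = go z (<-wellFounded (f z))
    where
    go : ∀ z → Acc _<_ (f z) → P z → ∃ λ w → P w × ∀ {v} → P v → f w ≤ f v
    go z (acc smaller) Pz with anySubset? (λ w → P? w ×-dec (f w <ℕ? f z))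
    ... | yes (w , Pw , fw<fz) = go w (smaller fw<fz) Pw
    ... | no  none            = z , Pz , λ Pv → ≮⇒≥ (λ fv<fz → none (_ , Pv , fv<fz))

module MatroidProperties (M : Matroid) where
  open Matroid M
  open ≤-Reasoning

  -- λ(X) + r(M), which avoids the truncated subtraction in `conn`
  conn⁺ : Subset n → ℕ
  conn⁺ X = r X + r (∁ X)

  r-⊥ : r ⊥ ≡ 0
  r-⊥ = n≤0⇒n≡0 (subst (r ⊥ ≤_) (∣⊥∣≡0 n) (r-bound ⊥))

  r≤r⊤ : ∀ X → r X ≤ r ⊤
  r≤r⊤ X = r-mono X ⊤ ⊆⊤

  r-sub-∁ : ∀ X Y → r (∁ (X ∪ Y)) + r (∁ (X ∩ Y)) ≤ r (∁ X) + r (∁ Y)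
  r-sub-∁ X Y = begin
    r (∁ (X ∪ Y)) + r (∁ (X ∩ Y)) ≡⟨ cong₂ (λ A B → r A + r B) (∁-∪ X Y) (∁-∩ X Y) ⟩
    r (∁ X ∩ ∁ Y) + r (∁ X ∪ ∁ Y) ≡⟨ +-comm (r (∁ X ∩ ∁ Y)) _ ⟩
    r (∁ X ∪ ∁ Y) + r (∁ X ∩ ∁ Y) ≤⟨ r-sub (∁ X) (∁ Y) ⟩
    r (∁ X) + r (∁ Y)             ∎

  conn⁺-∁ : ∀ X → conn⁺ (∁ X) ≡ conn⁺ X
  conn⁺-∁ X = trans (cong (λ Y → r (∁ X) + r Y) (∁-involutive X)) (+-comm (r (∁ X)) (r X))

  conn⁺-submodular : ∀ X Y → conn⁺ (X ∪ Y) + conn⁺ (X ∩ Y) ≤ conn⁺ X + conn⁺ Y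
  conn⁺-submodular X Y = begin
    conn⁺ (X ∪ Y) + conn⁺ (X ∩ Y)                              ≡⟨ interchange (r (X ∪ Y)) _ _ _ ⟩
    (r (X ∪ Y) + r (X ∩ Y)) + (r (∁ (X ∪ Y)) + r (∁ (X ∩ Y))) ≤⟨ +-mono-≤ (r-sub X Y) (r-sub-∁ X Y) ⟩
    (r X + r Y) + (r (∁ X) + r (∁ Y))                          ≡⟨ interchange (r X) (r Y) (r (∁ X)) _ ⟩
    conn⁺ X + conn⁺ Y                                          ∎

  MinimalAbove : Subset n → Subset n → Set
  MinimalAbove x X = x ⊆ X × (∀ {Z} → x ⊆ Z → Z ⊆ X → conn⁺ X ≤ conn⁺ Z)

  minimalAbove-exists : ∀ {x y} → Disjoint x y → ∃ λ X → MinimalAbove x X × MinimalAbove y (∁ X)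
  minimalAbove-exists {x} {y} x⊆∁y
    with X , (x⊆X , X⊆∁y) , minimal ← minimiser-exists (λ Z → x ⊆? Z ×-dec Z ⊆? ∁ y) conn⁺ (⊆-refl , x⊆∁y)
    = X , (x⊆X , λ x⊆Z Z⊆X → minimal (x⊆Z , ⊆-trans Z⊆X X⊆∁y))
        , (disjoint-sym X⊆∁y , λ {Z} y⊆Z Z⊆∁X → begin
             conn⁺ (∁ X) ≡⟨ conn⁺-∁ X ⟩
             conn⁺ X     ≤⟨ minimal (⊆-trans x⊆X (disjoint-sym Z⊆∁X) , p⊆q⇒∁p⊇∁q y⊆Z) ⟩
             conn⁺ (∁ Z) ≡⟨ conn⁺-∁ Z ⟩
             conn⁺ Z     ∎)

  minimalAbove-∪ : ∀ {x X s} → MinimalAbove x X → x ⊆ s → conn⁺ (s ∪ X) ≤ conn⁺ s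
  minimalAbove-∪ {x} {X} {s} (x⊆X , minimal) x⊆s = +-cancelʳ-≤ (conn⁺ (s ∩ X)) _ _ (begin
    conn⁺ (s ∪ X) + conn⁺ (s ∩ X) ≤⟨ conn⁺-submodular s X ⟩
    conn⁺ s + conn⁺ X             ≤⟨ +-monoʳ-≤ (conn⁺ s) (minimal (∩-greatest x⊆s x⊆X) (p∩q⊆q s X)) ⟩
    conn⁺ s + conn⁺ (s ∩ X)       ∎)

  minimalAbove-uncross : ∀ {x X t} → MinimalAbove x X → x ⊆ t →
                         r (∁ (t ∪ X)) + r X ≤ r (∁ t) + r (t ∩ X)
  minimalAbove-uncross {x} {X} {t} (x⊆X , minimal) x⊆t = +-cancelʳ-≤ (r (∁ (t ∩ X))) _ _
    (+-telescope (r (∁ (t ∪ X))) (r (∁ t)) (r X) (r (t ∩ X)) (r (∁ (t ∩ X))) (r (∁ X)) (r (∁ (t ∩ X)))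
      (r-sub-∁ t X)
      (minimal (∩-greatest x⊆t x⊆X) (p∩q⊆q t X)))

  r∁∪-telescope : ∀ {X Q ts} → AllPairs Disjoint ts → Q ⊆ X → All (Disjoint Q) ts →
                  ∑ (λ t → r (∁ t ∪ X)) ts + r Q ≤ ∑ (r ∘ ∁) ts + r X
  r∁∪-telescope [] Q⊆X [] = r-mono _ _ Q⊆X
  r∁∪-telescope {X} {Q} {t ∷ ts} (t⊥ts ∷ ts⊥ts) Q⊆X (Q⊥t ∷ Q⊥ts) =
    +-telescope (r (∁ t ∪ X)) (r (∁ t)) (∑ (λ t → r (∁ t ∪ X)) ts) (∑ (r ∘ ∁) ts) (r Q) (r Q′) (r X)
      step (r∁∪-telescope ts⊥ts Q′⊆X Q′⊥ts)
    where
    Q′ = Q ∪ (X ∩ t)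
    ∁t∪X⊆∁t∪Q′ : ∁ t ∪ X ⊆ ∁ t ∪ Q′
    ∁t∪X⊆∁t∪Q′ = ∪-least (p⊆p∪q Q′) λ {i} i∈X → case i ∈? t of λ where
      (yes i∈t) → q⊆p∪q (∁ t) Q′ (q⊆p∪q Q (X ∩ t) (x∈p∩q⁺ (i∈X , i∈t)))
      (no  i∉t) → p⊆p∪q Q′ (x∉p⇒x∈∁p i∉t)
    Q⊆∁t∩Q′ : Q ⊆ ∁ t ∩ Q′
    Q⊆∁t∩Q′ i∈Q = x∈p∩q⁺ (Q⊥t i∈Q , p⊆p∪q (X ∩ t) i∈Q)
    step : r (∁ t ∪ X) + r Q ≤ r (∁ t) + r Q′
    step = ≤-trans (+-mono-≤ (r-mono _ _ ∁t∪X⊆∁t∪Q′) (r-mono _ _ Q⊆∁t∩Q′)) (r-sub (∁ t) Q′)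
    Q′⊆X : Q′ ⊆ X
    Q′⊆X = ∪-least Q⊆X (p∩q⊆p X t)
    Q′⊥ts : All (Disjoint Q′) ts
    Q′⊥ts = All.zipWith {P = Disjoint Q} {Q = Disjoint t} {R = Disjoint Q′}
      (λ (Q⊥u , t⊥u) → ∪-least Q⊥u (⊆-trans (p∩q⊆q X t) t⊥u)) (Q⊥ts , t⊥ts)

  minimalAbove-uncross-star : ∀ {x X t₀ ts} → MinimalAbove x X → x ⊆ t₀ →
    All (Disjoint t₀) ts → AllPairs Disjoint ts →
    r (∁ (t₀ ∪ X)) + ∑ (λ t → r (∁ t ∪ X)) ts ≤ r (∁ t₀) + ∑ (r ∘ ∁) ts
  minimalAbove-uncross-star {X = X} {t₀} {ts} min@(x⊆X , _) x⊆t₀ t₀⊥ts ts⊥ts = +-cancelʳ-≤ (r X) _ _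
    (+-telescope (r (∁ (t₀ ∪ X))) (r (∁ t₀)) (∑ (λ t → r (∁ t ∪ X)) ts) (∑ (r ∘ ∁) ts)
                 (r X) (r (t₀ ∩ X)) (r X)
      (minimalAbove-uncross min x⊆t₀)
      (r∁∪-telescope ts⊥ts (p∩q⊆q t₀ X)
        (All.map {P = Disjoint t₀} {Q = Disjoint (t₀ ∩ X)} (disjoint-mono (p∩q⊆p t₀ X) ⊆-refl) t₀⊥ts)))

module Separations (M : Matroid) (k : ℕ) where
  open Matroid M
  open Theory M k
  open MatroidProperties M

  ⊆⇒≼ : ∀ {s t} → s ⊆ t → s ≼ t
  ⊆⇒≼ s⊆t = s⊆t , p⊆q⇒∁p⊇∁q s⊆t

  InS-minimalAbove : ∀ {x X} → InS x → MinimalAbove x X → InS X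
  InS-minimalAbove x∈S (x⊆X , minimal) = ≤-<-trans (∸-monoˡ-≤ rM (minimal ⊆-refl x⊆X)) x∈S

  emulates-minimalAbove : ∀ {x X} → InS x → MinimalAbove x X → emulates X x
  emulates-minimalAbove x∈S min@(x⊆X , _) =
    InS-minimalAbove x∈S min , ⊆⇒≼ x⊆X ,
    λ s s∈S _ (x⊆s , _) → ≤-<-trans (∸-monoˡ-≤ rM (minimalAbove-∪ min x⊆s)) s∈S

  deficit : Sep → ℕ
  deficit s = rM ∸ r (big s)

  deficit-self-disjoint : ∀ {s} → Disjoint s s → deficit s ≡ 0
  deficit-self-disjoint {s} s⊥s = m≤n⇒m∸n≡0 (r-mono ⊤ (∁ s) (self-disjoint⇒⊤⊆∁ s⊥s))

  sumℤ-excess : ∀ xs → sumℤ (map (λ s → + r (big s) ℤ.- + rM) xs) ≡ ℤ.- (+ ∑ deficit xs)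
  sumℤ-excess []       = refl
  sumℤ-excess (s ∷ xs) = begin
    (+ r (∁ s) ℤ.- + rM) ℤ.+ sumℤ (map (λ s → + r (big s) ℤ.- + rM) xs)
      ≡⟨ cong₂ ℤ._+_ (trans (ℤP.[+m]-[+n]≡m⊖n (r (∁ s)) rM) (ℤP.⊖-≤ (r≤r⊤ (∁ s)))) (sumℤ-excess xs) ⟩
    ℤ.- (+ deficit s) ℤ.+ ℤ.- (+ ∑ deficit xs)
      ≡⟨ ℤP.neg-distrib-+ (+ deficit s) _ ⟨
    ℤ.- (+ deficit s ℤ.+ + ∑ deficit xs)
      ≡⟨ cong ℤ.-_ (ℤP.pos-+ (deficit s) _) ⟨
    ℤ.- (+ (deficit s + ∑ deficit xs))
      ∎
    where open ≡-Reasoning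

  starOrd-≡ : ∀ σ → starOrd σ ≡ + rM ℤ.- + ∑ deficit (deduplicate _≟ₛ_ σ)
  starOrd-≡ σ = cong (ℤ._+_ (+ rM)) (sumℤ-excess (deduplicate _≟ₛ_ σ))

  starOrd-antitone : ∀ σ τ → ∑ deficit (deduplicate _≟ₛ_ σ) ≤ ∑ deficit (deduplicate _≟ₛ_ τ) →
                     starOrd τ ℤ.≤ starOrd σ
  starOrd-antitone σ τ le = begin
    starOrd τ                                      ≡⟨ starOrd-≡ τ ⟩
    + rM ℤ.- + ∑ deficit (deduplicate _≟ₛ_ τ)     ≤⟨ ℤP.+-monoʳ-≤ (+ rM) (ℤP.neg-mono-≤ (ℤ.+≤+ le)) ⟩
    + rM ℤ.- + ∑ deficit (deduplicate _≟ₛ_ σ)     ≡⟨ starOrd-≡ σ ⟨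
    starOrd σ                                      ∎
    where open ℤP.≤-Reasoning

  module _ (X x : Sep) where

    fmap-⊇ : ∀ {t} → x ⊆ t → fmap X x t ≡ t ∪ X
    fmap-⊇ {t} x⊆t with x ⊆? t | ∁ t ⊆? ∁ x
    ... | yes _ | yes _      = refl
    ... | yes _ | no ∁t⊈∁x   = ⊥-elim (∁t⊈∁x (p⊆q⇒∁p⊇∁q x⊆t))
    ... | no x⊈t | _         = ⊥-elim (x⊈t x⊆t)

    fmap-⊉ : ∀ {t} → ¬ x ⊆ t → fmap X x t ≡ t ∩ ∁ X
    fmap-⊉ {t} x⊈t with x ⊆? t
    ... | yes x⊆t = ⊥-elim (x⊈t x⊆t)
    ... | no _    = ∁-∁∪ t X

    fmap-disjoint : ∀ {i₀ a b} → i₀ ∈ₛ x → Disjoint a b → Disjoint (fmap X x a) (fmap X x b)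
    fmap-disjoint {i₀} {a} {b} i₀∈x a⊥b = case ((x ⊆? a) , (x ⊆? b)) of λ where
      (yes x⊆a , yes x⊆b) → ⊥-elim (x∈∁p⇒x∉p (a⊥b (x⊆a i₀∈x)) (x⊆b i₀∈x))
      (yes x⊆a , no  x⊈b) → subst₂ Disjoint (sym (fmap-⊇ x⊆a)) (sym (fmap-⊉ x⊈b))
                              (disjoint-∪-∩∁ X a⊥b)
      (no  x⊈a , yes x⊆b) → subst₂ Disjoint (sym (fmap-⊉ x⊈a)) (sym (fmap-⊇ x⊆b))
                              (disjoint-sym (disjoint-∪-∩∁ X (disjoint-sym a⊥b)))
      (no  x⊈a , no  x⊈b) → subst₂ Disjoint (sym (fmap-⊉ x⊈a)) (sym (fmap-⊉ x⊈b))
                              (disjoint-mono (p∩q⊆p a (∁ X)) (p∩q⊆p b (∁ X)) a⊥b)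

    map-fmap-IsStar : Nonempty x → ∀ {σ} → IsStar σ → IsStar (map (fmap X x) σ)
    map-fmap-IsStar (i₀ , i₀∈x) {σ} (_ , σ-pairs) = (λ s _ → ∁-fixpoint-free i₀ s) , pairs
      where
      pairs : ∀ s t → s ∈ map (fmap X x) σ → t ∈ map (fmap X x) σ → s ≢ t → s ≼ (t *)
      pairs _ _ s∈ t∈ s≢t with ∈-map⁻ (fmap X x) s∈ | ∈-map⁻ (fmap X x) t∈
      ... | a , a∈σ , refl | b , b∈σ , refl =
        ⊆⇒≼ (fmap-disjoint i₀∈x (proj₁ (σ-pairs a b a∈σ b∈σ λ a≡b → s≢t (cong (fmap X x) a≡b))))

    ∑-deficit-fmap : Nonempty x → MinimalAbove x X → ∀ {t₀ ts} → x ⊆ t₀ →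
                     AllPairs Disjoint (t₀ ∷ ts) →
                     ∑ deficit (t₀ ∷ ts) ≤ ∑ (deficit ∘ fmap X x) (t₀ ∷ ts)
    ∑-deficit-fmap (i₀ , i₀∈x) min {t₀} {ts} x⊆t₀ (t₀⊥ts ∷ ts⊥ts) =
      ∑-∸-antitone {u = r ∘ ∁ ∘ fmap X x} {v = r ∘ ∁} {rM} {t₀ ∷ ts}
        (All.tabulate λ _ → r≤r⊤ _) (All.tabulate λ _ → r≤r⊤ _) (begin
        r (∁ (fmap X x t₀)) + ∑ (r ∘ ∁ ∘ fmap X x) ts
          ≡⟨ cong (λ t → r (∁ t) + ∑ (r ∘ ∁ ∘ fmap X x) ts) (fmap-⊇ x⊆t₀) ⟩
        r (∁ (t₀ ∪ X)) + ∑ (r ∘ ∁ ∘ fmap X x) ts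
          ≤⟨ +-monoʳ-≤ (r (∁ (t₀ ∪ X))) (∑-mono {u = r ∘ ∁ ∘ fmap X x} {v = λ t → r (∁ t ∪ X)} {ts}
               (All.tabulate λ t∈ts → ≤-reflexive (r∁-fmap (All.lookup t₀⊥ts t∈ts)))) ⟩
        r (∁ (t₀ ∪ X)) + ∑ (λ t → r (∁ t ∪ X)) ts
          ≤⟨ minimalAbove-uncross-star min x⊆t₀ t₀⊥ts ts⊥ts ⟩
        r (∁ t₀) + ∑ (r ∘ ∁) ts
          ∎)
      where
      open ≤-Reasoning
      r∁-fmap : ∀ {t} → Disjoint t₀ t → r (∁ (fmap X x t)) ≡ r (∁ t ∪ X)
      r∁-fmap {t} t₀⊥t = cong r (trans (cong ∁ (fmap-⊉ λ x⊆t → x∈∁p⇒x∉p (t₀⊥t (x⊆t₀ i₀∈x)) (x⊆t i₀∈x)))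
                                       (∁-∩∁ t X))

    map-fmap-InF : Nonempty x → MinimalAbove x X → ∀ {σ} → InF σ → (∃ λ t₀ → t₀ ∈ σ × x ≼ t₀) →
                   InF (map (fmap X x) σ)
    map-fmap-InF x≢∅@(i₀ , i₀∈x) min {σ} (σ-star , ⟨σ⟩<k) (t₀ , t₀∈σ , x⊆t₀ , _) =
      map-fmap-IsStar x≢∅ σ-star , ℤP.≤-<-trans (starOrd-antitone σ (map f σ) deficits) ⟨σ⟩<k
      where
      open ≤-Reasoning
      f = fmap X x
      D  = deduplicate _≟ₛ_ σ
      D′ = deduplicate _≟ₛ_ (map f σ)
      L  = deduplicate _≟ₛ_ (t₀ ∷ σ)
      L⊆σ : ∀ {t} → t ∈ L → t ∈ σ
      L⊆σ t∈L with ∈-deduplicate⁻ _≟ₛ_ (t₀ ∷ σ) t∈L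
      ... | here refl = t₀∈σ
      ... | there t∈σ = t∈σ
      L-disjoint : AllPairs Disjoint L
      L-disjoint = Unique⇒AllPairs (deduplicate-! _≟ₛ_ (t₀ ∷ σ))
        λ s∈L t∈L s≢t → proj₁ (proj₂ σ-star _ _ (L⊆σ s∈L) (L⊆σ t∈L) s≢t)
      fL-repeats : AllPairs (λ s t → s ≡ t → deficit s ≡ 0) (map f L)
      fL-repeats = AllPairsP.map⁺ (AllPairs.map {R = Disjoint} (λ {a} {b} a⊥b fa≡fb →
        deficit-self-disjoint (subst (Disjoint (f a)) (sym fa≡fb) (fmap-disjoint i₀∈x a⊥b))) L-disjoint)
      fL⊆D′ : ∀ {t} → t ∈ map f L → t ∈ D′
      fL⊆D′ t∈fL with a , a∈L , refl ← ∈-map⁻ f t∈fL = ∈-deduplicate⁺ _≟ₛ_ (∈-map⁺ f (L⊆σ a∈L))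
      deficits : ∑ deficit D ≤ ∑ deficit D′
      deficits = begin
        ∑ deficit D         ≤⟨ ∑-⊆ (AllPairs.map (λ s≢t s≡t → ⊥-elim (s≢t s≡t)) (deduplicate-! _≟ₛ_ σ))
                                   (λ t∈D → ∈-deduplicate⁺ _≟ₛ_ (there (∈-deduplicate⁻ _≟ₛ_ σ t∈D))) ⟩
        ∑ deficit L         ≤⟨ ∑-deficit-fmap x≢∅ min x⊆t₀ L-disjoint ⟩
        ∑ (deficit ∘ f) L   ≡⟨ ∑-map deficit f L ⟨
        ∑ deficit (map f L) ≤⟨ ∑-⊆ fL-repeats fL⊆D′ ⟩
        ∑ deficit D′        ∎

  emulatesFor-minimalAbove : ∀ {x X} → InS x → Nonempty x → MinimalAbove x X → emulatesFor X x
  emulatesFor-minimalAbove {x} {X} x∈S x≢∅ min =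
    emulates-minimalAbove x∈S min , λ _ _ → map-fmap-InF X x x≢∅ min

  -- An empty x is forced, since ⟨{x*}⟩ = r(∅) = 0 < k.
  nice⇒nonempty : 0 < k → ∀ {x} → nice x → Nonempty x
  nice⇒nonempty 0<k {x} (_ , _ , x≢x* , unforced) with nonempty? x
  ... | yes x≢∅ = x≢∅
  ... | no  x≡∅ = ⊥-elim (unforced (x*-star , ℤP.≤-<-trans (ℤP.≤-reflexive ⟨x*⟩≡0) (ℤ.+<+ 0<k)))
    where
    x*-star : IsStar (x * ∷ [])
    x*-star = (λ { _ (here refl) x*≡x** → x≢x* (∁-injective x*≡x**) })
            , (λ { _ _ (here refl) (here refl) s≢t → ⊥-elim (s≢t refl) })
    ∑deficit≡rM : ∑ deficit (x * ∷ []) ≡ rM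
    ∑deficit≡rM rewrite ∁-involutive x | Empty-unique x≡∅ | r-⊥ = +-identityʳ rM
    ⟨x*⟩≡0 : starOrd (x * ∷ []) ≡ + 0
    ⟨x*⟩≡0 = begin
      starOrd (x * ∷ [])                ≡⟨ starOrd-≡ (x * ∷ []) ⟩
      + rM ℤ.- + ∑ deficit (x * ∷ [])   ≡⟨ cong (λ m → + rM ℤ.- + m) ∑deficit≡rM ⟩
      + rM ℤ.- + rM                     ≡⟨ ℤP.+-inverseʳ (+ rM) ⟩
      + 0                               ∎
      where open ≡-Reasoning

lemma8p3 : (M : Matroid) (k : ℕ) → 0 < k → Separable M k
lemma8p3 M k 0<k x x′ x-nice x′-nice (x⊆∁x′ , _)
  with X , X-minimal , X*-minimal ← MatroidProperties.minimalAbove-exists M x⊆∁x′ =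
  X , InS-minimalAbove (proj₁ x-nice) X-minimal
    , emulatesFor-minimalAbove (proj₁ x-nice) (nice⇒nonempty 0<k x-nice) X-minimal
    , emulatesFor-minimalAbove (proj₁ x′-nice) (nice⇒nonempty 0<k x′-nice) X*-minimal
  where open Separations M k
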